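{- Let $\varepsilon\ge0$ and let $\phi_v$ ($v\in V$) be the final values computed by Algorithm A (described in the context) at the end of the stream. Then every matching $M^*$ of $G$ satisfies $$w(M^*)\le OPT(LP)\le(1+\varepsilon)\sum_{v\in V}\phi_v,$$ where $OPT(LP)$ is the optimal value of the linear program: maximize $\sum_{e\in E}w_ex_e$ subject to $\sum_{e\ni v}x_e\le1$ for all $v\in V$ and $x_e\ge0$ for all $e\in E$.
   Context: $G=(V,E,w)$ is a simple graph with positive edge weights; $w(M)=\sum_{e\in M}w_e$. The edges arrive in a stream in arbitrary order. Algorithm A with parameter $\varepsilon$: initialize an empty stack $S$ and $\phi_v=0$ for every vertex $v$. For each edge $e=\{u,v\}$ in stream order: if $w_e<(1+\varepsilon)(\phi_u+\phi_v)$, skip $e$; otherwise set $w'_e=w_e-(\phi_u+\phi_v)$, then $\phi_u\leftarrow\phi_u+w'_e$, $\phi_v\leftarrow\phi_v+w'_e$, and push $e$ onto $S$.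
   Formalization: The edge weights $w_e$, the parameter ε and the variables $x_e$ of the linear program take values in ℚ. -}

module Defs where

open import Data.Nat using (ℕ; zero; suc)
open import Data.Fin using (Fin; zero; suc; _≟_)
open import Data.Bool using (Bool; true; false; if_then_else_)
open import Data.Product using (_×_; _,_)
open import Data.Sum using (_⊎_)
open import Data.Vec using (Vec; lookup; toList)
open import Data.List using (List; foldl)
open import Data.Rational using (ℚ; 0ℚ; 1ℚ; _+_; _-_; _*_; _≤_; _<_)
open import Data.Rational.Properties using (_<?_)
open import Data.Empty using (⊥)
open import Relation.Nullary using (¬_; does)
open import Relation.Binary.PropositionalEquality using (_≡_; _≢_)

record Edge (n : ℕ) : Set where
  constructor edge
  field
    eu : Fin n
    ev : Fin n
    wt : ℚ
open Edge public

sumFin : (m : ℕ) → (Fin m → ℚ) → ℚ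
sumFin zero    f = 0ℚ
sumFin (suc m) f = f zero + sumFin m (λ i → f (suc i))

-- The graph on vertex set Fin n is given by its m edges, listed in stream
-- order (edge i arrives at time i).  Simple graph with positive weights:
SameEnds : {n : ℕ} → Edge n → Edge n → Set
SameEnds e f = (eu e ≡ eu f × ev e ≡ ev f) ⊎ (eu e ≡ ev f × ev e ≡ eu f)

SimplePositive : {n m : ℕ} → Vec (Edge n) m → Set
SimplePositive {n} {m} E =
  ((i : Fin m) → eu (lookup E i) ≢ ev (lookup E i)) ×
  ((i j : Fin m) → i ≢ j → ¬ SameEnds (lookup E i) (lookup E j)) ×
  ((i : Fin m) → 0ℚ < wt (lookup E i))

incident : {n : ℕ} → Fin n → Edge n → Bool
incident x e = if does (x ≟ eu e) then true else does (x ≟ ev e)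

-- One step of Algorithm A (the stack S does not influence the φ values).
stepA : {n : ℕ} → ℚ → (Fin n → ℚ) → Edge n → (Fin n → ℚ)
stepA ε φ (edge u v w) =
  if does (w <? ((1ℚ + ε) * (φ u + φ v)))
  then φ
  else (λ x → if does (x ≟ u) then φ u + w'
              else if does (x ≟ v) then φ v + w'
              else φ x)
  where
  w' : ℚ
  w' = w - (φ u + φ v)

runA : {n m : ℕ} → ℚ → Vec (Edge n) m → (Fin n → ℚ)
runA ε E = foldl (stepA ε) (λ _ → 0ℚ) (toList E)

IsMatching : {n m : ℕ} → Vec (Edge n) m → (Fin m → Bool) → Set
IsMatching {n} {m} E M =
  (i j : Fin m) → M i ≡ true → M j ≡ true → i ≢ j →
  (x : Fin n) → incident x (lookup E i) ≡ true → incident x (lookup E j) ≡ true → ⊥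

matchWeight : {n m : ℕ} → Vec (Edge n) m → (Fin m → Bool) → ℚ
matchWeight {n} {m} E M = sumFin m (λ i → if M i then wt (lookup E i) else 0ℚ)

LPFeasible : {n m : ℕ} → Vec (Edge n) m → (Fin m → ℚ) → Set
LPFeasible {n} {m} E x =
  ((i : Fin m) → 0ℚ ≤ x i) ×
  ((v : Fin n) → sumFin m (λ i → if incident v (lookup E i) then x i else 0ℚ) ≤ 1ℚ)

lpValue : {n m : ℕ} → Vec (Edge n) m → (Fin m → ℚ) → ℚ
lpValue {n} {m} E x = sumFin m (λ i → wt (lookup E i) * x i)

{-# OPTIONS --safe #-}

-- The scaled potentials (1 + ε) φ form a feasible solution of the dual LP, a fractional vertex
-- cover (y ≥ 0 and w_e ≤ y_u + y_v for every edge), so weak LP duality bounds every fractional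
-- matching, in particular the indicator vector of a matching, by (1 + ε) Σ φ.  Dual feasibility
-- holds because every edge satisfies w_e ≤ (1 + ε) (φ_u + φ_v) right after it is processed (when
-- skipped, by the test itself; when pushed, φ_u + φ_v becomes 2 w_e − (φ_u + φ_v) ≥ w_e), and the
-- potentials never decrease.
module Submission where

open import Defs
open import Data.Nat using (ℕ; zero; suc)
open import Data.Fin using (Fin; zero; suc; _≟_)
open import Data.Fin.Properties using (suc-injective)
open import Data.Bool using (Bool; true; false; if_then_else_; _∧_)
open import Data.Vec using (Vec; lookup; toList; _∷_)
open import Data.List using ([]; _∷_; foldl)
open import Data.Product using (_×_; Σ; _,_)
open import Function using (_∘_)
open import Relation.Nullary using (¬_; Dec; does; yes; no)
open import Relation.Nullary.Decidable using (dec-true; dec-false)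
open import Relation.Binary.PropositionalEquality
  using (_≡_; _≢_; refl; sym; trans; cong; cong₂; module ≡-Reasoning)
open import Data.Rational using (ℚ; 0ℚ; 1ℚ; _+_; -_; _-_; _*_; _≤_; _<_; nonNegative)
open import Data.Rational.Properties
  using (_<?_; ≤-refl; ≤-trans; ≤-reflexive; <⇒≤; ≮⇒≥; nonNegative⁻¹; +-mono-≤; +-monoˡ-≤;
         +-monoʳ-≤; *-monoˡ-≤-nonNeg; *-monoʳ-≤-nonNeg; +-identityˡ; +-identityʳ; +-comm;
         +-inverseʳ; *-identityˡ; *-identityʳ; *-zeroʳ; *-distribˡ-+; *-distribʳ-+;
         +-*-commutativeRing; module ≤-Reasoning)
open import Data.Rational.Solver using (module +-*-Solver)
open import Algebra.Bundles using (CommutativeRing)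
open import Algebra.Properties.Semiring.Sum (CommutativeRing.semiring +-*-commutativeRing)
  using (sum; ∑-comm; *-distribˡ-sum; sum-cong-≗; sum-replicate-zero)

p≤p+q : ∀ {p q} → 0ℚ ≤ q → p ≤ p + q
p≤p+q {p} 0≤q = ≤-trans (≤-reflexive (sym (+-identityʳ p))) (+-monoʳ-≤ p 0≤q)

p≤q⇒0≤q-p : ∀ {p q} → p ≤ q → 0ℚ ≤ q - p
p≤q⇒0≤q-p {p} p≤q = ≤-trans (≤-reflexive (sym (+-inverseʳ p))) (+-monoˡ-≤ (- p) p≤q)

sumFin≡sum : ∀ m (f : Fin m → ℚ) → sumFin m f ≡ sum f
sumFin≡sum zero    f = refl
sumFin≡sum (suc m) f = cong (f zero +_) (sumFin≡sum m (f ∘ suc))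

sumFin-cong : ∀ m {f g : Fin m → ℚ} → (∀ i → f i ≡ g i) → sumFin m f ≡ sumFin m g
sumFin-cong m {f} {g} f≗g =
  trans (sumFin≡sum m f) (trans (sum-cong-≗ f≗g) (sym (sumFin≡sum m g)))

*-distribˡ-sumFin : ∀ m c (f : Fin m → ℚ) → c * sumFin m f ≡ sumFin m (λ i → c * f i)
*-distribˡ-sumFin m c f = begin
  c * sumFin m f             ≡⟨ cong (c *_) (sumFin≡sum m f) ⟩
  c * sum f                  ≡⟨ *-distribˡ-sum c f ⟩
  sum (λ i → c * f i)        ≡⟨ sumFin≡sum m _ ⟨
  sumFin m (λ i → c * f i)   ∎
  where open ≡-Reasoning

sum-mono : ∀ {m} {f g : Fin m → ℚ} → (∀ i → f i ≤ g i) → sum f ≤ sum g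
sum-mono {zero}  f≤g = ≤-refl
sum-mono {suc m} f≤g = +-mono-≤ (f≤g zero) (sum-mono (f≤g ∘ suc))

sum-zero : ∀ {m} {f : Fin m → ℚ} → (∀ i → f i ≡ 0ℚ) → sum f ≡ 0ℚ
sum-zero {m} f≗0 = trans (sum-cong-≗ f≗0) (sum-replicate-zero m)

sum-single : ∀ {m} (f : Fin m → ℚ) {i : Fin m} → (∀ j → j ≢ i → f j ≡ 0ℚ) → sum f ≡ f i
sum-single f {zero} f≗0 =
  trans (cong (f zero +_) (sum-zero (λ j → f≗0 (suc j) λ ()))) (+-identityʳ (f zero))
sum-single f {suc i} f≗0 =
  trans (cong₂ _+_ (f≗0 zero λ ()) (sum-single (f ∘ suc) λ j j≢i → f≗0 (suc j) (j≢i ∘ suc-injective)))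
        (+-identityˡ (f (suc i)))

sum-pair : ∀ {m} (f : Fin m → ℚ) {i j : Fin m} → i ≢ j →
           (∀ k → k ≢ i → k ≢ j → f k ≡ 0ℚ) → sum f ≡ f i + f j
sum-pair f {zero} {zero} i≢j f≗0 with () ← i≢j refl
sum-pair f {zero} {suc j} i≢j f≗0 =
  cong (f zero +_) (sum-single (f ∘ suc) λ k k≢j → f≗0 (suc k) (λ ()) (k≢j ∘ suc-injective))
sum-pair f {suc i} {zero} i≢j f≗0 =
  trans (cong (f zero +_) (sum-single (f ∘ suc) λ k k≢i → f≗0 (suc k) (k≢i ∘ suc-injective) (λ ())))
        (+-comm (f zero) (f (suc i)))
sum-pair f {suc i} {suc j} i≢j f≗0 =
  trans (cong₂ _+_ (f≗0 zero (λ ()) (λ ()))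
                   (sum-pair (f ∘ suc) (i≢j ∘ cong suc)
                      λ k k≢i k≢j → f≗0 (suc k) (k≢i ∘ suc-injective) (k≢j ∘ suc-injective)))
        (+-identityˡ (f (suc i) + f (suc j)))

indicator : Bool → ℚ
indicator b = if b then 1ℚ else 0ℚ

indicator-∧ : ∀ b c → indicator (b ∧ c) ≡ (if b then indicator c else 0ℚ)
indicator-∧ true  c = refl
indicator-∧ false c = refl

*-indicator : ∀ q b → q * indicator b ≡ (if b then q else 0ℚ)
*-indicator q true  = *-identityʳ q
*-indicator q false = *-zeroʳ q

0≤indicator : ∀ b → 0ℚ ≤ indicator b
0≤indicator true  = nonNegative⁻¹ 1ℚ
0≤indicator false = ≤-refl

sum-indicator≤1 : ∀ {m} (b : Fin m → Bool) →
                  (∀ i j → b i ≡ true → b j ≡ true → i ≡ j) → sum (indicator ∘ b) ≤ 1ℚ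
sum-indicator≤1 {zero}  b unique = nonNegative⁻¹ 1ℚ
sum-indicator≤1 {suc m} b unique with b zero in b₀≡true
... | true  = ≤-reflexive (trans (cong (1ℚ +_) (sum-zero others)) (+-identityʳ 1ℚ))
  where
  others : ∀ i → indicator (b (suc i)) ≡ 0ℚ
  others i with b (suc i) in bᵢ≡true
  ... | true with () ← unique zero (suc i) b₀≡true bᵢ≡true
  ... | false = refl
... | false = ≤-trans (≤-reflexive (+-identityˡ _))
                (sum-indicator≤1 (b ∘ suc) λ i j p q → suc-injective (unique (suc i) (suc j) p q))

∧-≡-true : ∀ {a b} → a ∧ b ≡ true → a ≡ true × b ≡ true
∧-≡-true {true} {true} refl = refl , refl

incident-eu : ∀ {n} (e : Edge n) → incident (eu e) e ≡ true
incident-eu e rewrite dec-true (eu e ≟ eu e) refl = refl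

incident-ev : ∀ {n} (e : Edge n) → incident (ev e) e ≡ true
incident-ev e with does (ev e ≟ eu e)
... | true  = refl
... | false = dec-true (ev e ≟ ev e) refl

incident-other : ∀ {n} {x : Fin n} (e : Edge n) → x ≢ eu e → x ≢ ev e → incident x e ≡ false
incident-other {x = x} e x≢u x≢v rewrite dec-false (x ≟ eu e) x≢u | dec-false (x ≟ ev e) x≢v = refl

Loopless : ∀ {n m} → Vec (Edge n) m → Set
Loopless E = ∀ i → eu (lookup E i) ≢ ev (lookup E i)

sum-incident : ∀ {n} (y : Fin n → ℚ) (a : ℚ) (e : Edge n) → eu e ≢ ev e →
               sum (λ x → y x * (if incident x e then a else 0ℚ)) ≡ (y (eu e) + y (ev e)) * a
sum-incident y a e u≢v = begin
  sum (λ x → y x * (if incident x e then a else 0ℚ))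
    ≡⟨ sum-pair _ u≢v (λ x x≢u x≢v → trans (cong (λ b → y x * (if b then a else 0ℚ))
                                                  (incident-other e x≢u x≢v))
                                            (*-zeroʳ (y x))) ⟩
  y (eu e) * (if incident (eu e) e then a else 0ℚ) + y (ev e) * (if incident (ev e) e then a else 0ℚ)
    ≡⟨ cong₂ (λ b c → y (eu e) * (if b then a else 0ℚ) + y (ev e) * (if c then a else 0ℚ))
             (incident-eu e) (incident-ev e) ⟩
  y (eu e) * a + y (ev e) * a
    ≡⟨ *-distribʳ-+ a (y (eu e)) (y (ev e)) ⟨
  (y (eu e) + y (ev e)) * a ∎
  where open ≡-Reasoning

DualFeasible : ∀ {n m} → Vec (Edge n) m → (Fin n → ℚ) → Set
DualFeasible {n} {m} E y =
  ((v : Fin n) → 0ℚ ≤ y v) ×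
  ((i : Fin m) → wt (lookup E i) ≤ y (eu (lookup E i)) + y (ev (lookup E i)))

weak-duality : ∀ {n m} (E : Vec (Edge n) m) → Loopless E → {x : Fin m → ℚ} {y : Fin n → ℚ} →
               LPFeasible E x → DualFeasible E y → lpValue E x ≤ sumFin n y
weak-duality {n} {m} E loopless {x} {y} (0≤x , load≤1) (0≤y , covers) = begin
  lpValue E x
    ≡⟨ sumFin≡sum m _ ⟩
  sum (λ i → wt (e i) * x i)
    ≤⟨ sum-mono (λ i → *-monoʳ-≤-nonNeg (x i) {{nonNegative (0≤x i)}} (covers i)) ⟩
  sum (λ i → (y (eu (e i)) + y (ev (e i))) * x i)
    ≡⟨ sum-cong-≗ (λ i → sum-incident y (x i) (e i) (loopless i)) ⟨
  sum (λ i → sum (λ v → y v * load v i))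
    ≡⟨ ∑-comm (λ i v → y v * load v i) ⟩
  sum (λ v → sum (λ i → y v * load v i))
    ≡⟨ sum-cong-≗ (λ v → *-distribˡ-sum (y v) (load v)) ⟨
  sum (λ v → y v * sum (load v))
    ≤⟨ sum-mono (λ v → *-monoˡ-≤-nonNeg (y v) {{nonNegative (0≤y v)}}
                         (≤-trans (≤-reflexive (sym (sumFin≡sum m (load v)))) (load≤1 v))) ⟩
  sum (λ v → y v * 1ℚ)
    ≡⟨ sum-cong-≗ (λ v → *-identityʳ (y v)) ⟩
  sum y
    ≡⟨ sumFin≡sum n y ⟨
  sumFin n y ∎
  where
  open ≤-Reasoning
  e : Fin m → Edge _
  e = lookup E
  load : Fin n → Fin m → ℚ
  load v i = if incident v (e i) then x i else 0ℚ

matching-isLPFeasible : ∀ {n m} (E : Vec (Edge n) m) {M : Fin m → Bool} →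
                        IsMatching E M → LPFeasible E (indicator ∘ M)
matching-isLPFeasible {n} {m} E {M} matching = 0≤indicator ∘ M , load≤1
  where
  incidentIn : Fin n → Fin m → Bool
  incidentIn v i = incident v (lookup E i) ∧ M i

  atMostOne : ∀ v i j → incidentIn v i ≡ true → incidentIn v j ≡ true → i ≡ j
  atMostOne v i j vi vj with i ≟ j | ∧-≡-true vi | ∧-≡-true vj
  ... | yes i≡j | _ | _ = i≡j
  ... | no i≢j | v∈eᵢ , i∈M | v∈eⱼ , j∈M with () ← matching i j i∈M j∈M i≢j v v∈eᵢ v∈eⱼ

  load≤1 : ∀ v → sumFin m (λ i → if incident v (lookup E i) then indicator (M i) else 0ℚ) ≤ 1ℚ
  load≤1 v = ≤-trans (≤-reflexive (trans (sumFin-cong m (λ i → sym (indicator-∧ _ (M i))))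
                                         (sumFin≡sum m (indicator ∘ incidentIn v))))
                     (sum-indicator≤1 (incidentIn v) (atMostOne v))

matchWeight≡lpValue : ∀ {n m} (E : Vec (Edge n) m) (M : Fin m → Bool) →
                      matchWeight E M ≡ lpValue E (indicator ∘ M)
matchWeight≡lpValue {m = m} E M = sumFin-cong m (λ i → sym (*-indicator (wt (lookup E i)) (M i)))

raise : ∀ {n} → (Fin n → ℚ) → Fin n → Fin n → ℚ → Fin n → ℚ
raise φ u v δ x = if does (x ≟ u) then φ u + δ else if does (x ≟ v) then φ v + δ else φ x

raise-grows : ∀ {n} (φ : Fin n → ℚ) (u v : Fin n) {δ} → 0ℚ ≤ δ → ∀ x → φ x ≤ raise φ u v δ x
raise-grows φ u v 0≤δ x with x ≟ u | x ≟ v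
... | yes refl | _        = p≤p+q 0≤δ
... | no _     | yes refl = p≤p+q 0≤δ
... | no _     | no _     = ≤-refl

raise-eu : ∀ {n} (φ : Fin n → ℚ) (u v : Fin n) δ → raise φ u v δ u ≡ φ u + δ
raise-eu φ u v δ rewrite dec-true (u ≟ u) refl = refl

raise-ev : ∀ {n} (φ : Fin n → ℚ) {u v : Fin n} δ → u ≢ v → raise φ u v δ v ≡ φ v + δ
raise-ev φ {u} {v} δ u≢v rewrite dec-false (v ≟ u) (u≢v ∘ sym) | dec-true (v ≟ v) refl = refl

NonNeg : ∀ {n} → (Fin n → ℚ) → Set
NonNeg φ = ∀ x → 0ℚ ≤ φ x

module AlgorithmA (ε : ℚ) (0≤ε : 0ℚ ≤ ε) where

  0≤1+ε : 0ℚ ≤ 1ℚ + ε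
  0≤1+ε = ≤-trans (nonNegative⁻¹ 1ℚ) (p≤p+q 0≤ε)

  ≤-scale : ∀ {q} → 0ℚ ≤ q → q ≤ (1ℚ + ε) * q
  ≤-scale {q} 0≤q = ≤-trans (≤-reflexive (sym (*-identityˡ q)))
                            (*-monoʳ-≤-nonNeg q {{nonNegative 0≤q}} (p≤p+q {1ℚ} 0≤ε))

  Covered : ∀ {n} → (Fin n → ℚ) → Edge n → Set
  Covered φ e = wt e ≤ (1ℚ + ε) * (φ (eu e) + φ (ev e))

  covered-mono : ∀ {n} {φ ψ : Fin n → ℚ} (e : Edge n) →
                 (∀ x → φ x ≤ ψ x) → Covered φ e → Covered ψ e
  covered-mono e φ≤ψ covered =
    ≤-trans covered (*-monoˡ-≤-nonNeg (1ℚ + ε) {{nonNegative 0≤1+ε}}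
                                      (+-mono-≤ (φ≤ψ (eu e)) (φ≤ψ (ev e))))

  stepA-cases : ∀ {n} (φ : Fin n → ℚ) (u v : Fin n) (w : ℚ) (P : (Fin n → ℚ) → Set) →
                (w < (1ℚ + ε) * (φ u + φ v) → P φ) →
                (¬ (w < (1ℚ + ε) * (φ u + φ v)) → P (raise φ u v (w - (φ u + φ v)))) →
                P (stepA ε φ (edge u v w))
  stepA-cases φ u v w P skip push = by-decision (w <? (1ℚ + ε) * (φ u + φ v))
    where
    by-decision : (d : Dec (w < (1ℚ + ε) * (φ u + φ v))) →
                  P (if does d then φ else raise φ u v (w - (φ u + φ v)))
    by-decision (yes lt) = skip lt
    by-decision (no w≮)  = push w≮

  0≤gain : ∀ {s w} → 0ℚ ≤ s → ¬ (w < (1ℚ + ε) * s) → 0ℚ ≤ w - s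
  0≤gain 0≤s w≮ = p≤q⇒0≤q-p (≤-trans (≤-scale 0≤s) (≮⇒≥ w≮))

  stepA-grows : ∀ {n} {φ : Fin n → ℚ} → NonNeg φ → ∀ e x → φ x ≤ stepA ε φ e x
  stepA-grows {φ = φ} 0≤φ (edge u v w) x = stepA-cases φ u v w (λ ψ → φ x ≤ ψ x) (λ _ → ≤-refl)
    λ w≮ → raise-grows φ u v (0≤gain (+-mono-≤ (0≤φ u) (0≤φ v)) w≮) x

  stepA-nonNeg : ∀ {n} {φ : Fin n → ℚ} → NonNeg φ → ∀ e → NonNeg (stepA ε φ e)
  stepA-nonNeg 0≤φ e x = ≤-trans (0≤φ x) (stepA-grows 0≤φ e x)

  raise-covers : ∀ {n} {φ : Fin n → ℚ} {u v w} → NonNeg φ → u ≢ v → ¬ (w < (1ℚ + ε) * (φ u + φ v)) →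
                 Covered (raise φ u v (w - (φ u + φ v))) (edge u v w)
  raise-covers {φ = φ} {u} {v} {w} 0≤φ u≢v w≮
    rewrite raise-eu φ u v (w - (φ u + φ v)) | raise-ev φ (w - (φ u + φ v)) u≢v = begin
      w                                       ≤⟨ p≤p+q 0≤w' ⟩
      w + w'                                  ≡⟨ regroup (φ u) (φ v) w ⟩
      (φ u + w') + (φ v + w')                 ≤⟨ ≤-scale (+-mono-≤ (≤-trans (0≤φ u) (p≤p+q 0≤w'))
                                                                   (≤-trans (0≤φ v) (p≤p+q 0≤w'))) ⟩
      (1ℚ + ε) * ((φ u + w') + (φ v + w'))    ∎
    where
    open ≤-Reasoning
    open +-*-Solver
    w' : ℚ
    w' = w - (φ u + φ v)
    0≤w' : 0ℚ ≤ w'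
    0≤w' = 0≤gain (+-mono-≤ (0≤φ u) (0≤φ v)) w≮
    regroup : ∀ a b w → w + (w - (a + b)) ≡ (a + (w - (a + b))) + (b + (w - (a + b)))
    regroup = solve 3 (λ a b w → w :+ (w :- (a :+ b)) := (a :+ (w :- (a :+ b))) :+ (b :+ (w :- (a :+ b)))) refl

  stepA-covers : ∀ {n} {φ : Fin n → ℚ} → NonNeg φ → (e : Edge n) → eu e ≢ ev e →
                 Covered (stepA ε φ e) e
  stepA-covers {φ = φ} 0≤φ (edge u v w) u≢v =
    stepA-cases φ u v w (λ ψ → Covered ψ (edge u v w)) <⇒≤ (raise-covers 0≤φ u≢v)

  foldl-grows : ∀ {n} {φ : Fin n → ℚ} → NonNeg φ → ∀ es x → φ x ≤ foldl (stepA ε) φ es x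
  foldl-grows 0≤φ []       x = ≤-refl
  foldl-grows 0≤φ (e ∷ es) x = ≤-trans (stepA-grows 0≤φ e x) (foldl-grows (stepA-nonNeg 0≤φ e) es x)

  foldl-covers : ∀ {n m} (E : Vec (Edge n) m) → Loopless E → {φ : Fin n → ℚ} → NonNeg φ →
                 ∀ i → Covered (foldl (stepA ε) φ (toList E)) (lookup E i)
  foldl-covers (e ∷ E) loopless 0≤φ zero =
    covered-mono e (foldl-grows (stepA-nonNeg 0≤φ e) (toList E)) (stepA-covers 0≤φ e (loopless zero))
  foldl-covers (e ∷ E) loopless 0≤φ (suc i) =
    foldl-covers E (loopless ∘ suc) (stepA-nonNeg 0≤φ e) i

  runA-dualFeasible : ∀ {n m} (E : Vec (Edge n) m) → Loopless E →
                      DualFeasible E (λ v → (1ℚ + ε) * runA ε E v)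
  runA-dualFeasible E loopless =
    (λ v → ≤-trans (0≤φ v) (≤-scale (0≤φ v))) ,
    (λ i → ≤-trans (foldl-covers E loopless (λ _ → ≤-refl) i) (≤-reflexive (*-distribˡ-+ (1ℚ + ε) _ _)))
    where
    0≤φ : NonNeg (runA ε E)
    0≤φ = foldl-grows (λ _ → ≤-refl) (toList E)

corollary4 : (n m : ℕ) (E : Vec (Edge n) m) → SimplePositive E →
    (ε : ℚ) → 0ℚ ≤ ε →
    ((M : Fin m → Bool) → IsMatching E M →
       Σ (Fin m → ℚ) (λ x → LPFeasible E x × matchWeight E M ≤ lpValue E x)) ×
    ((x : Fin m → ℚ) → LPFeasible E x →
       lpValue E x ≤ (1ℚ + ε) * sumFin n (runA ε E))
corollary4 n m E (loopless , _ , _) ε 0≤ε =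
  (λ M matching → indicator ∘ M , matching-isLPFeasible E matching , ≤-reflexive (matchWeight≡lpValue E M)) ,
  λ x feasible → begin
    lpValue E x                              ≤⟨ weak-duality E loopless feasible (runA-dualFeasible E loopless) ⟩
    sumFin n (λ v → (1ℚ + ε) * runA ε E v)   ≡⟨ *-distribˡ-sumFin n (1ℚ + ε) (runA ε E) ⟨
    (1ℚ + ε) * sumFin n (runA ε E)           ∎
  where
  open AlgorithmA ε 0≤ε
  open ≤-Reasoning
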